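{- Let a finite concurrent system with processes $P=\{1,\dots,n\}$, global state space $G$, local state spaces $L_p$, initial sets $\mathit{Init}_p\subseteq G\times L_p$, transition relations $\stackrel{p}{\to}$ and error specification $(\langle p_1,E_1\rangle,\dots,\langle p_m,E_m\rangle)$ be given (all as described in the context). If, for some invariant schema $A$, the Horn constraints (C1)–(C3) described in the context are solvable, i.e. there exist relations $R_{\bar a}$ ($\bar a\in A$) making all of them true, then the system is safe.
   Context: A system consists of: a non-empty set $G$ of global states; the process index set $P=\{1,\dots,n\}$; for each $p\in P$ a non-empty set $L_p$ of local states, a set $\mathit{Init}_p\subseteq G\times L_p$ of initial states, and a transition relation $(g,l)\stackrel{p}{\to}(g',l')$ on $G\times L_p$. The system state space is $S=G\times\prod_{p\in P}L_p$; for $s=(g,\bar l)$, $\bar l[p]\in L_p$ is the component of process $p$, and $\bar l[p/l']$ is $\bar l$ with component $p$ replaced by $l'$. Initial states: $S_0=\{(g,\bar l)\mid \forall p\in P.\ (g,\bar l[p])\in \mathit{Init}_p\}$. System transitions: $(g,\bar l)\to(g',\bar l[p/l'])$ whenever $p\in P$ and $(g,\bar l[p])\stackrel{p}{\to}(g',l')$. An error specification is a tuple $(\langle p_1,E_1\rangle,\dots,\langle p_m,E_m\rangle)$ with pairwise distinct $p_i\in P$ and $E_i\subseteq G\times L_{p_i}$; the error states are $\mathit{Err}=\{(g,\bar l)\in S\mid \forall i.\ (g,\bar l[p_i])\in E_i\}$. The system is safe if there is no finite sequence $s_0\to s_1\to\dots\to s_r$ with $s_0\in S_0$ and $s_r\in\mathit{Err}$.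 An invariant schema is an antichain $A\subseteq\{0,1\}^n$ with respect to the componentwise order on $\mathbb N^n$. For $\bar a=(a_1,\dots,a_n)\in A$ let $i_1<\dots<i_k$ be the indices with $a_i>0$, and for $\bar l\in\prod_p L_p$ write $\bar l[\bar a]=(\bar l[i_1],\dots,\bar l[i_k])$. For each $\bar a\in A$ there is an unknown relation $R_{\bar a}\subseteq G\times L_{i_1}\times\dots\times L_{i_k}$. For $Q\subseteq P$ define $\mathit{Ctxt}(Q,g,\bar l)=\bigwedge\{R_{\bar c}(g,\bar l[\bar c])\mid \bar c\in A,\ \exists q\in Q.\ \bar c[q]>0\}$, where $\bar c[q]$ is the $q$-th entry of $\bar c$. The Horn constraints are (all variables universally quantified): (C1) for each $\bar a\in A$ (with nonzero indices $i_1<\dots<i_k$): $R_{\bar a}(g,l_1,\dots,l_k)\leftarrow \mathit{Init}_{i_1}(g,l_1)\wedge\dots\wedge\mathit{Init}_{i_k}(g,l_k)$; (C2) for each $p\in\{1,\dots,n\}$ and $\bar a\in A$: $R_{\bar a}(g',\bar l[p/l'][\bar a])\leftarrow \big((g,\bar l[p])\stackrel{p}{\to}(g',l')\big)\wedge R_{\bar a}(g,\bar l[\bar a])\wedge \mathit{Ctxt}(\{p\},g,\bar l)$; (C3) $\mathit{false}\leftarrow \big(\bigwedge_{j=1}^m (g,\bar l[p_j])\in E_j\big)\wedge \mathit{Ctxt}(\{p_1,\dots,p_m\},g,\bar l)$. -}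

module Defs where

open import Data.Nat using (ℕ)
open import Data.Fin using (Fin; _≟_)
open import Data.Bool using (Bool; true; false)
open import Data.Product using (Σ; ∃; _×_; _,_)
open import Data.Empty using (⊥)
open import Data.Unit using (⊤)
open import Relation.Nullary using (¬_; yes; no)
open import Relation.Binary.PropositionalEquality using (_≡_; refl)

-- A concurrent system with process index set P = Fin n
-- (Fin n plays the role of {1,…,n}).
record System (n : ℕ) : Set₁ where
  field
    G      : Set
    L      : Fin n → Set
    g₀     : G
    l₀     : (p : Fin n) → L p
    Init   : (p : Fin n) → G → L p → Set
    Step   : (p : Fin n) → G → L p → G → L p → Set

module _ {n : ℕ} (S : System n) where
  open System S

  LVec : Set
  LVec = (p : Fin n) → L p

  upd : LVec → (p : Fin n) → L p → LVec
  upd l p l' q with p ≟ q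
  ... | yes refl = l'
  ... | no _     = l q

  InitState : G → LVec → Set
  InitState g l = (p : Fin n) → Init p g (l p)

  data _⟶_ : G × LVec → G × LVec → Set where
    step : ∀ {g : G} {l : LVec} {g' : G} (p : Fin n) {l' : L p} →
           Step p g (l p) g' l' →
           (g , l) ⟶ (g' , upd l p l')

  data Reachable : G × LVec → Set where
    init : ∀ {g l} → InitState g l → Reachable (g , l)
    next : ∀ {s s'} → Reachable s → s ⟶ s' → Reachable s'

record ErrSpec {n : ℕ} (S : System n) : Set₁ where
  open System S
  field
    m        : ℕ
    proc     : Fin m → Fin n
    distinct : ∀ i j → proc i ≡ proc j → i ≡ j
    E        : (i : Fin m) → G → L (proc i) → Set

module _ {n : ℕ} {S : System n} (Sp : ErrSpec S) where
  open System S
  open ErrSpec Sp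

  Err : G × LVec S → Set
  Err (g , l) = (i : Fin m) → E i g (l (proc i))

  ErrProcs : Fin n → Set
  ErrProcs q = ∃ λ i → proc i ≡ q

  Safe : Set
  Safe = ¬ (Σ (G × LVec S) λ s → Reachable S s × Err s)

BVec : ℕ → Set
BVec n = Fin n → Bool

_≤b_ : Bool → Bool → Set
false ≤b _ = ⊤
true  ≤b b = b ≡ true

_≼_ : {n : ℕ} → BVec n → BVec n → Set
a ≼ b = ∀ q → a q ≤b b q

IsAntichain : {n : ℕ} → (BVec n → Set) → Set
IsAntichain {n} A = ∀ a b → A a → A b → a ≼ b → ∀ q → a q ≡ b q

module _ {n : ℕ} (S : System n) where
  open System S

  -- l̄[ā]: the tuple of components at the indices i with a_i > 0
  -- (represented as a dependent function on those indices)
  Restr : BVec n → Set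
  Restr a = (q : Fin n) → a q ≡ true → L q

  restrict : LVec S → (a : BVec n) → Restr a
  restrict l a q _ = l q

  Relations : (BVec n → Set) → Set₁
  Relations A = (a : BVec n) → A a → G → Restr a → Set

  Ctxt : (A : BVec n → Set) → Relations A → (Fin n → Set) → G → LVec S → Set
  Ctxt A R Q g l = ∀ c (c∈A : A c) → (∃ λ q → Q q × c q ≡ true) →
                   R c c∈A g (restrict l c)

  C1 : (A : BVec n → Set) → Relations A → Set
  C1 A R = ∀ a (a∈A : A a) g (r : Restr a) →
           (∀ q (h : a q ≡ true) → Init q g (r q h)) → R a a∈A g r

  C2 : (A : BVec n → Set) → Relations A → Set
  C2 A R = ∀ (p : Fin n) a (a∈A : A a) g (l : LVec S) g' (l' : L p) →
           Step p g (l p) g' l' →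
           R a a∈A g (restrict l a) →
           Ctxt A R (λ q → q ≡ p) g l →
           R a a∈A g' (restrict (upd S l p l') a)

  C3 : (A : BVec n → Set) → Relations A → ErrSpec S → Set
  C3 A R Sp = ∀ g (l : LVec S) →
              (∀ i → E i g (l (proc i))) →
              Ctxt A R (ErrProcs Sp) g l → ⊥
    where open ErrSpec Sp

  HornSolvable : (A : BVec n → Set) → ErrSpec S → Set₁
  HornSolvable A Sp = Σ (Relations A) λ R → C1 A R × C2 A R × C3 A R Sp

module Submission where

-- Read a solution (R_ā)_{ā∈A} of (C1)–(C2) as a candidate inductive invariant:
-- a system state (g, l̄) "satisfies R" when R_ā(g, l̄[ā]) holds for every ā ∈ A.
-- (C1) says every initial state satisfies R, and (C2) says satisfaction of R is
-- preserved by every transition, because the context Ctxt({p}, g, l̄) required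
-- by (C2) is a sub-conjunction of "satisfies R".  By induction on reachability,
-- every reachable state satisfies R.  Finally (C3) forbids an error state whose
-- context Ctxt({p₁,…,pₘ}, g, l̄) holds, and that context again follows from
-- satisfying R; so no error state is reachable.
--
-- Only (C1)–(C3) are used.

open import Defs
open import Data.Nat using (ℕ)
open import Data.Fin using (Fin)
open import Data.Product using (_,_)
open import Relation.Binary.PropositionalEquality using (_≡_)

module Invariant {n : ℕ} (S : System n) (A : BVec n → Set) (R : Relations S A) where
  open System S

  Satisfies : G → LVec S → Set
  Satisfies g l = ∀ a (a∈A : A a) → R a a∈A g (restrict S l a)

  satisfies⇒ctxt : ∀ {g l} (Q : Fin n → Set) → Satisfies g l → Ctxt S A R Q g l
  satisfies⇒ctxt Q sat c c∈A _ = sat c c∈A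

  initial-satisfies : C1 S A R → ∀ {g l} → InitState S g l → Satisfies g l
  initial-satisfies c1 {g} {l} initial a a∈A = c1 a a∈A g (restrict S l a) (λ q _ → initial q)

  step-preserves : C2 S A R → ∀ {g l g' l'} →
                   _⟶_ S (g , l) (g' , l') → Satisfies g l → Satisfies g' l'
  step-preserves c2 {g} {l} (step p st) sat a a∈A =
    c2 p a a∈A g l _ _ st (sat a a∈A) (satisfies⇒ctxt (λ q → q ≡ p) sat)

  reachable-satisfies : C1 S A R → C2 S A R →
                        ∀ {g l} → Reachable S (g , l) → Satisfies g l
  reachable-satisfies c1 c2 (init i) = initial-satisfies c1 i
  reachable-satisfies c1 c2 (next {_ , _} r t) =
    step-preserves c2 t (reachable-satisfies c1 c2 r)

mainTheorem1 : (n : ℕ) (S : System n) (Sp : ErrSpec S)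
               (A : BVec n → Set) → IsAntichain A →
               HornSolvable S A Sp → Safe Sp
mainTheorem1 n S Sp A _ (R , c1 , c2 , c3) ((g , l) , reach , err) =
  c3 g l err (satisfies⇒ctxt (ErrProcs Sp) (reachable-satisfies c1 c2 reach))
  where open Invariant S A R
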